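{- The logic sBIL is implicative: for all propositional variables $p,q,r$ the following hold: (IL1) $\vdash_s p\to p$; (IL2) $p\to q,\ q\to r\vdash_s p\to r$; (IL3) for every connective $\lambda\in\{\top,\bot,\wedge,\vee,\to,\prec\}$ of arity $n$ and variables $p_1,\dots,p_n,q_1,\dots,q_n$: $\{p_k\to q_k\mid 1\le k\le n\}\cup\{q_k\to p_k\mid 1\le k\le n\}\vdash_s \lambda p_1\dots p_n\to\lambda q_1\dots q_n$; (IL4) $p,\ p\to q\vdash_s q$; (IL5) $p\vdash_s q\to p$.
   Context: Fix a countably infinite set $\mathrm{Prop}$ of propositional variables. Bi-intuitionistic formulas are generated by $\phi ::= p \mid \bot \mid \top \mid \phi\wedge\phi \mid \phi\vee\phi \mid \phi\to\phi \mid \phi\prec\phi$ with $p\in\mathrm{Prop}$, where $\prec$ is the binary exclusion connective. Abbreviations: $\neg\phi := \phi\to\bot$, ${\sim}\phi := \top\prec\phi$, $\phi\leftrightarrow\psi := (\phi\to\psi)\wedge(\psi\to\phi)$. An axiom is any instance of: (A1) $\phi\to(\psi\to\phi)$; (A2) $(\phi\to(\psi\to\chi))\to((\phi\to\psi)\to(\phi\to\chi))$; (A3) $\phi\to(\phi\vee\psi)$; (A4) $\psi\to(\phi\vee\psi)$; (A5) $(\phi\to\chi)\to((\psi\to\chi)\to((\phi\vee\psi)\to\chi))$; (A6) $(\phi\wedge\psi)\to\phi$; (A7) $(\phi\wedge\psi)\to\psi$; (A8) $(\chi\to\phi)\to((\chi\to\psi)\to(\chi\to(\phi\wedge\psi)))$;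 (A9) $\bot\to\phi$; (A10) $\phi\to\top$; (A11) $\phi\to(\psi\vee(\phi\prec\psi))$; (A12) $(\phi\prec\psi)\to{\sim}(\phi\to\psi)$; (A13) $((\phi\prec\psi)\prec\chi)\to(\phi\prec(\psi\vee\chi))$; (A14) $\neg(\phi\prec\psi)\to(\phi\to\psi)$. The logic sBIL is the relation $\Gamma\vdash_s\phi$ (for a set of formulas $\Gamma$ and a formula $\phi$) that holds iff $\Gamma\vdash\phi$ is derivable with the rules: (Ax) $\Gamma\vdash\phi$ for any axiom $\phi$; (El) $\Gamma\vdash\phi$ if $\phi\in\Gamma$; (MP) from $\Gamma\vdash\phi$ and $\Gamma\vdash\phi\to\psi$ infer $\Gamma\vdash\psi$; (sDN) from $\Gamma\vdash\phi$ infer $\Gamma\vdash\neg{\sim}\phi$. We write $\vdash_s\phi$ for $\emptyset\vdash_s\phi$ and list finitely many premises separated by commas. -}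

module Defs where

open import Data.Nat using (ℕ)
open import Data.Product using (_×_)
open import Data.Sum using (_⊎_)
open import Relation.Binary.PropositionalEquality using (_≡_)
open import Level using (0ℓ)

Var : Set
Var = ℕ

infixr 20 _⇒_
infixr 21 _≺_
infixr 22 _∨'_
infixr 23 _∧'_

data Fm : Set where
  var  : Var → Fm
  ⊥'   : Fm
  ⊤'   : Fm
  _∧'_ : Fm → Fm → Fm
  _∨'_ : Fm → Fm → Fm
  _⇒_  : Fm → Fm → Fm
  _≺_  : Fm → Fm → Fm

¬' : Fm → Fm
¬' φ = φ ⇒ ⊥'

∼' : Fm → Fm
∼' φ = ⊤' ≺ φ

_⇔'_ : Fm → Fm → Fm
φ ⇔' ψ = (φ ⇒ ψ) ∧' (ψ ⇒ φ)

data Axiom : Fm → Set where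
  A1  : ∀ φ ψ → Axiom (φ ⇒ (ψ ⇒ φ))
  A2  : ∀ φ ψ χ → Axiom ((φ ⇒ (ψ ⇒ χ)) ⇒ ((φ ⇒ ψ) ⇒ (φ ⇒ χ)))
  A3  : ∀ φ ψ → Axiom (φ ⇒ (φ ∨' ψ))
  A4  : ∀ φ ψ → Axiom (ψ ⇒ (φ ∨' ψ))
  A5  : ∀ φ ψ χ → Axiom ((φ ⇒ χ) ⇒ ((ψ ⇒ χ) ⇒ ((φ ∨' ψ) ⇒ χ)))
  A6  : ∀ φ ψ → Axiom ((φ ∧' ψ) ⇒ φ)
  A7  : ∀ φ ψ → Axiom ((φ ∧' ψ) ⇒ ψ)
  A8  : ∀ φ ψ χ → Axiom ((χ ⇒ φ) ⇒ ((χ ⇒ ψ) ⇒ (χ ⇒ (φ ∧' ψ))))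
  A9  : ∀ φ → Axiom (⊥' ⇒ φ)
  A10 : ∀ φ → Axiom (φ ⇒ ⊤')
  A11 : ∀ φ ψ → Axiom (φ ⇒ (ψ ∨' (φ ≺ ψ)))
  A12 : ∀ φ ψ → Axiom ((φ ≺ ψ) ⇒ ∼' (φ ⇒ ψ))
  A13 : ∀ φ ψ χ → Axiom (((φ ≺ ψ) ≺ χ) ⇒ (φ ≺ (ψ ∨' χ)))
  A14 : ∀ φ ψ → Axiom (¬' (φ ≺ ψ) ⇒ (φ ⇒ ψ))

FmSet : Set₁
FmSet = Fm → Set

infix 4 _⊢s_
data _⊢s_ (Γ : FmSet) : Fm → Set where
  ax  : ∀ {φ} → Axiom φ → Γ ⊢s φ
  el  : ∀ {φ} → Γ φ → Γ ⊢s φ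
  mp  : ∀ {φ ψ} → Γ ⊢s φ → Γ ⊢s (φ ⇒ ψ) → Γ ⊢s ψ
  sdn : ∀ {φ} → Γ ⊢s φ → Γ ⊢s ¬' (∼' φ)

∅ : FmSet
∅ _ = Data.Empty.⊥
  where import Data.Empty

⟦_⟧ : Fm → FmSet
⟦ a ⟧ φ = φ ≡ a

⟦_,_⟧ : Fm → Fm → FmSet
⟦ a , b ⟧ φ = (φ ≡ a) ⊎ (φ ≡ b)

⟦_,_,_,_⟧ : Fm → Fm → Fm → Fm → FmSet
⟦ a , b , c , d ⟧ φ = (φ ≡ a) ⊎ (φ ≡ b) ⊎ (φ ≡ c) ⊎ (φ ≡ d)

CongIL3 : Var → Var → Var → Var → (Fm → Fm → Fm) → Set
CongIL3 p₁ p₂ q₁ q₂ λ' =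
  ⟦ var p₁ ⇒ var q₁ , var p₂ ⇒ var q₂ , var q₁ ⇒ var p₁ , var q₂ ⇒ var p₂ ⟧
    ⊢s (λ' (var p₁) (var p₂) ⇒ λ' (var q₁) (var q₂))

-- The Hilbert-style calculus contains the implicational fragment of intuitionistic
-- logic (A1, A2), so identity, weakening and transitivity of → are derivable, and
-- ∧, ∨, → are monotone by their introduction/elimination axioms. The only new point
-- is monotonicity of ≺, which rests on residuation: from φ → ψ ∨ χ the rule sDN gives
-- ¬∼(φ → ψ ∨ χ), while A13 and A12 give (φ ≺ ψ) ≺ χ → ∼(φ → ψ ∨ χ); hence
-- ¬((φ ≺ ψ) ≺ χ), and A14 turns this into (φ ≺ ψ) → χ.
module Submission where

open import Defs
open import Data.Product using (_×_)
import Data.Product as Product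
open import Data.Sum using (inj₁; inj₂)
open import Relation.Binary.PropositionalEquality using (refl)

module _ {Γ : FmSet} where

  ⇒-refl : ∀ φ → Γ ⊢s (φ ⇒ φ)
  ⇒-refl φ = mp (ax (A1 φ φ)) (mp (ax (A1 φ (φ ⇒ φ))) (ax (A2 φ (φ ⇒ φ) φ)))

  ⇒-weaken : ∀ {φ} ψ → Γ ⊢s φ → Γ ⊢s (ψ ⇒ φ)
  ⇒-weaken {φ} ψ ⊢φ = mp ⊢φ (ax (A1 φ ψ))

  mp-under : ∀ {χ φ ψ} → Γ ⊢s (χ ⇒ (φ ⇒ ψ)) → Γ ⊢s (χ ⇒ φ) → Γ ⊢s (χ ⇒ ψ)
  mp-under {χ} {φ} {ψ} ⊢χφψ ⊢χφ = mp ⊢χφ (mp ⊢χφψ (ax (A2 χ φ ψ)))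

  ⇒-trans : ∀ {φ ψ χ} → Γ ⊢s (φ ⇒ ψ) → Γ ⊢s (ψ ⇒ χ) → Γ ⊢s (φ ⇒ χ)
  ⇒-trans {φ} ⊢φψ ⊢ψχ = mp-under (⇒-weaken φ ⊢ψχ) ⊢φψ

  ⇒-compose : ∀ φ ψ χ → Γ ⊢s ((ψ ⇒ χ) ⇒ ((φ ⇒ ψ) ⇒ (φ ⇒ χ)))
  ⇒-compose φ ψ χ = ⇒-trans (ax (A1 (ψ ⇒ χ) φ)) (ax (A2 φ ψ χ))

  ∧-mono : ∀ {φ ψ φ′ ψ′} → Γ ⊢s (φ ⇒ φ′) → Γ ⊢s (ψ ⇒ ψ′) → Γ ⊢s ((φ ∧' ψ) ⇒ (φ′ ∧' ψ′))
  ∧-mono {φ} {ψ} {φ′} {ψ′} ⊢φ ⊢ψ =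
    mp (⇒-trans (ax (A7 φ ψ)) ⊢ψ) (mp (⇒-trans (ax (A6 φ ψ)) ⊢φ) (ax (A8 φ′ ψ′ (φ ∧' ψ))))

  ∨-mono : ∀ {φ ψ φ′ ψ′} → Γ ⊢s (φ ⇒ φ′) → Γ ⊢s (ψ ⇒ ψ′) → Γ ⊢s ((φ ∨' ψ) ⇒ (φ′ ∨' ψ′))
  ∨-mono {φ} {ψ} {φ′} {ψ′} ⊢φ ⊢ψ =
    mp (⇒-trans ⊢ψ (ax (A4 φ′ ψ′))) (mp (⇒-trans ⊢φ (ax (A3 φ′ ψ′))) (ax (A5 φ ψ (φ′ ∨' ψ′))))

  ⇒-mono : ∀ {φ ψ φ′ ψ′} → Γ ⊢s (φ′ ⇒ φ) → Γ ⊢s (ψ ⇒ ψ′) → Γ ⊢s ((φ ⇒ ψ) ⇒ (φ′ ⇒ ψ′))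
  ⇒-mono {φ} {ψ} {φ′} {ψ′} ⊢φ ⊢ψ =
    ⇒-trans (mp-under (⇒-compose φ′ φ ψ) (⇒-weaken (φ ⇒ ψ) ⊢φ)) (mp ⊢ψ (⇒-compose φ′ ψ ψ′))

  ≺-residuate : ∀ {φ ψ χ} → Γ ⊢s (φ ⇒ (ψ ∨' χ)) → Γ ⊢s ((φ ≺ ψ) ⇒ χ)
  ≺-residuate {φ} {ψ} {χ} ⊢φψχ =
    mp (⇒-trans (⇒-trans (ax (A13 φ ψ χ)) (ax (A12 φ (ψ ∨' χ)))) (sdn ⊢φψχ))
       (ax (A14 (φ ≺ ψ) χ))

  ≺-mono : ∀ {φ ψ φ′ ψ′} → Γ ⊢s (φ ⇒ φ′) → Γ ⊢s (ψ′ ⇒ ψ) → Γ ⊢s ((φ ≺ ψ) ⇒ (φ′ ≺ ψ′))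
  ≺-mono {φ′ = φ′} {ψ′} ⊢φ ⊢ψ =
    ≺-residuate (⇒-trans (⇒-trans ⊢φ (ax (A11 φ′ ψ′))) (∨-mono ⊢ψ (⇒-refl (φ′ ≺ ψ′))))

module _ {a b c d : Fm} where

  first : ⟦ a , b , c , d ⟧ ⊢s a
  first = el (inj₁ refl)

  second : ⟦ a , b , c , d ⟧ ⊢s b
  second = el (inj₂ (inj₁ refl))

  third : ⟦ a , b , c , d ⟧ ⊢s c
  third = el (inj₂ (inj₂ (inj₁ refl)))

  fourth : ⟦ a , b , c , d ⟧ ⊢s d
  fourth = el (inj₂ (inj₂ (inj₂ refl)))

mainTheorem1 :
      (∀ (p : Var) → ∅ ⊢s (var p ⇒ var p))
    × (∀ (p q r : Var) → ⟦ var p ⇒ var q , var q ⇒ var r ⟧ ⊢s (var p ⇒ var r))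
    × (∅ ⊢s (⊤' ⇒ ⊤'))
    × (∅ ⊢s (⊥' ⇒ ⊥'))
    × (∀ (p₁ p₂ q₁ q₂ : Var) → CongIL3 p₁ p₂ q₁ q₂ _∧'_)
    × (∀ (p₁ p₂ q₁ q₂ : Var) → CongIL3 p₁ p₂ q₁ q₂ _∨'_)
    × (∀ (p₁ p₂ q₁ q₂ : Var) → CongIL3 p₁ p₂ q₁ q₂ _⇒_)
    × (∀ (p₁ p₂ q₁ q₂ : Var) → CongIL3 p₁ p₂ q₁ q₂ _≺_)
    × (∀ (p q : Var) → ⟦ var p , var p ⇒ var q ⟧ ⊢s var q)
    × (∀ (p q : Var) → ⟦ var p ⟧ ⊢s (var q ⇒ var p))
mainTheorem1 =
    (λ p → ⇒-refl (var p))
  Product., (λ _ _ _ → ⇒-trans (el (inj₁ refl)) (el (inj₂ refl)))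
  Product., ⇒-refl ⊤'
  Product., ⇒-refl ⊥'
  Product., (λ _ _ _ _ → ∧-mono first second)
  Product., (λ _ _ _ _ → ∨-mono first second)
  Product., (λ _ _ _ _ → ⇒-mono third second)
  Product., (λ _ _ _ _ → ≺-mono first fourth)
  Product., (λ _ _ → mp (el (inj₁ refl)) (el (inj₂ refl)))
  Product., (λ _ q → ⇒-weaken (var q) (el refl))
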